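{- Let $r=r(z)=\frac{1-2z^2-\sqrt{1-4z^2}}{2z^2}$. For $k\ge0$ let $f_k(z)$ (resp. $g_k(z)$) be the generating function whose coefficient of $z^n$ is the number of partial zigzag knight's paths of length $n$ (number of steps) ending at height $k$ whose last step is an up-step $N$ or $E$ (resp. a down-step $\bar N$ or $\bar E$), the empty path being counted in $f_0$. Let $F(u)=\sum_{k\ge0}u^kf_k$ and $G(u)=\sum_{k\ge0}u^kg_k$. Then $$F(u)=\frac{ru^2+ur(1-z)+z}{z(1-ru)},\qquad G(u)=\frac{r(u+r+2)}{1-ru},\qquad F(u)+G(u)=\frac{r^2z+ru^2+ru+2rz+z}{z(1-ru)}.$$ Moreover $f_0=1$; $f_k=\frac{1+r}{z}r^{k-1}-[k=1]\frac1z$ for $k\ge1$; $g_0=r(2+r)$; and $g_k=\frac{r^{k+1}}{z^2}$ for $k\ge1$, where $[k=1]$ equals $1$ if $k=1$ and $0$ otherwise.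
   Context: Let $N=(1,2)$, $\bar N=(1,-2)$, $E=(2,1)$, $\bar E=(2,-1)$; $N,E$ are up-steps and $\bar N,\bar E$ are down-steps. A knight's path is a lattice path in $\mathbb N^2$ starting at $(0,0)$, ending on the $x$-axis, with steps in $\{N,\bar N,E,\bar E\}$. A zigzag knight's path is a knight's path in which consecutive steps alternate between up-steps and down-steps. A partial zigzag knight's path is a prefix (possibly empty) of a zigzag knight's path. The length of a path is its number of steps; the height of a point is its ordinate. -}

module Defs where

open import Data.Nat using (ℕ; zero; suc; _∸_; _≡ᵇ_)
open import Data.Integer as ℤ using (ℤ; +_; 0ℤ; 1ℤ)
open import Data.Bool using (Bool; true; false; not; if_then_else_)
open import Data.List using (List; []; _∷_; _++_; length; last)
open import Data.List.Membership.Propositional using (_∈_)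
open import Data.List.Relation.Unary.Unique.Propositional using (Unique)
open import Data.Maybe using (Maybe; just; nothing)
open import Data.Product using (Σ; ∃; ∃-syntax; _×_)
open import Data.Sum using (_⊎_)
open import Function.Bundles using (_⇔_)
open import Relation.Binary.PropositionalEquality using (_≡_)

-- N = (1,2), N̄ = (1,-2), E = (2,1), Ē = (2,-1)
data Step : Set where
  N N̄ E Ē : Step

isUp : Step → Bool
isUp N = true
isUp E = true
isUp N̄ = false
isUp Ē = false

-- One step from height h; nothing if the path would leave ℕ² (height < 0).
-- (The abscissa is always ≥ 0 since every step moves right.)
step : ℕ → Step → Maybe ℕ
step h N = just (suc (suc h))
step h E = just (suc h)
step (suc (suc h)) N̄ = just h
step _ N̄ = nothing
step (suc h) Ē = just h
step zero Ē = nothing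

walk : ℕ → List Step → Maybe ℕ
walk h [] = just h
walk h (s ∷ p) with step h s
... | just h' = walk h' p
... | nothing = nothing

KnightPath : List Step → Set
KnightPath p = walk 0 p ≡ just 0

Alternating : List Step → Set
Alternating [] = Data.Unit.⊤ where import Data.Unit
Alternating (s ∷ []) = Data.Unit.⊤ where import Data.Unit
Alternating (s ∷ t ∷ p) = (isUp t ≡ not (isUp s)) × Alternating (t ∷ p)

ZigzagKnightPath : List Step → Set
ZigzagKnightPath p = KnightPath p × Alternating p

PartialZigzag : List Step → Set
PartialZigzag p = ∃[ q ] ZigzagKnightPath (p ++ q)

EndsUpOrEmpty : List Step → Set
EndsUpOrEmpty p = (p ≡ []) ⊎ (∃[ s ] (last p ≡ just s × isUp s ≡ true))

EndsDown : List Step → Set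
EndsDown p = ∃[ s ] (last p ≡ just s × isUp s ≡ false)

UpPaths : ℕ → ℕ → List Step → Set
UpPaths n k p = length p ≡ n × PartialZigzag p × walk 0 p ≡ just k × EndsUpOrEmpty p

DownPaths : ℕ → ℕ → List Step → Set
DownPaths n k p = length p ≡ n × PartialZigzag p × walk 0 p ≡ just k × EndsDown p

HasCount : (List Step → Set) → ℕ → Set
HasCount P m = Σ (List (List Step)) λ xs →
  length xs ≡ m × Unique xs × (∀ p → (P p ⇔ (p ∈ xs)))

-- Formal power series in z over ℤ (coefficient sequences)

Ser : Set
Ser = ℕ → ℤ

infix 4 _≈_ _≈ᵇ_
infixl 6 _⊕_ _⊖_ _⊕ᵇ_ _⊖ᵇ_
infixl 7 _⊛_ _⊛ᵇ_
infixr 8 _^ₛ_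

_≈_ : Ser → Ser → Set
a ≈ b = ∀ n → a n ≡ b n

C : ℤ → Ser
C c zero = c
C c (suc n) = 0ℤ

Z : Ser
Z zero = 0ℤ
Z (suc zero) = 1ℤ
Z (suc (suc n)) = 0ℤ

_⊕_ : Ser → Ser → Ser
(a ⊕ b) n = a n ℤ.+ b n

_⊖_ : Ser → Ser → Ser
(a ⊖ b) n = a n ℤ.- b n

Σ≤ : ℕ → (ℕ → ℤ) → ℤ
Σ≤ zero h = h zero
Σ≤ (suc n) h = Σ≤ n h ℤ.+ h (suc n)

_⊛_ : Ser → Ser → Ser
(a ⊛ b) n = Σ≤ n (λ i → a i ℤ.* b (n ∸ i))

_^ₛ_ : Ser → ℕ → Ser
a ^ₛ zero = C 1ℤ
a ^ₛ suc k = a ⊛ (a ^ₛ k)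

[_≡1] : ℕ → ℤ
[ k ≡1] = if k ≡ᵇ 1 then 1ℤ else 0ℤ

-- Power series in u whose coefficients are power series in z:
-- A k is the coefficient of u^k.

BSer : Set
BSer = ℕ → Ser

_≈ᵇ_ : BSer → BSer → Set
A ≈ᵇ B = ∀ k → A k ≈ B k

ι : Ser → BSer
ι a zero = a
ι a (suc k) = C 0ℤ

U : BSer
U zero = C 0ℤ
U (suc zero) = C 1ℤ
U (suc (suc k)) = C 0ℤ

_⊕ᵇ_ : BSer → BSer → BSer
(A ⊕ᵇ B) k = A k ⊕ B k

_⊖ᵇ_ : BSer → BSer → BSer
(A ⊖ᵇ B) k = A k ⊖ B k

_⊛ᵇ_ : BSer → BSer → BSer
(A ⊛ᵇ B) k n = Σ≤ k (λ j → (A j ⊛ B (k ∸ j)) n)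

-- A partial zigzag path is an alternating path staying in ℕ²: any such path can be completed
-- by one down-step (if it ends with an up-step) followed by E N̄ pairs down to the x-axis.
-- Classifying these paths by their last step, an up-step follows a down-step or starts the
-- path, and a down-step follows an up-step; this gives the transfer equations
--   f₀ = 1,  f_(k+1) = z (g_k + g_(k-1) + [k ∈ {0,1}]),  g_k = z (f_(k+1) + f_(k+2)),
-- which determine all f_k, g_k since coefficient n + 1 only depends on coefficients n.
-- The closed forms satisfy them because r = z²(1 + r)², which follows by squaring the
-- definition of r. Finally (1 - r u) F, (1 - r u) G and (1 - r u)(F + G) are polynomials of
-- degree two in u, so the identities in u are checked on the coefficients of u⁰, u¹, u² and u^(3+j).

module Submission where

open import Defs
open import Data.Nat as ℕ using (ℕ; zero; suc; _≤_; _∸_; z≤n)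
import Data.Nat.Properties as ℕP
open import Data.Integer as ℤ using (ℤ; +_; 0ℤ; 1ℤ)
import Data.Integer.Properties as ℤP
open import Data.Product using (_×_; _,_; proj₁; proj₂; ∃-syntax)
open import Data.Sum using (_⊎_; inj₁; inj₂)
open import Data.Unit using (tt)
open import Data.Empty using (⊥)
open import Data.Bool using (Bool; true; false; not)
open import Data.Bool.Properties using (not-involutive)
open import Data.Maybe using (Maybe; just; nothing; maybe′)
open import Data.Maybe.Properties using (just-injective)
open import Data.List using (List; []; _∷_; _++_; _∷ʳ_; length; last; head; map; initLast; _∷ʳ′_)
open import Data.List.Properties using (length-++; length-map; ∷ʳ-injective; ∷ʳ-injectiveˡ)
open import Data.List.Membership.Propositional using (_∈_)
open import Data.List.Membership.Propositional.Properties using (∈-map⁺; ∈-map⁻; ∈-++⁺ˡ; ∈-++⁺ʳ; ∈-++⁻)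
open import Data.List.Membership.Propositional.Properties.WithK using (unique∧set⇒bag)
open import Data.List.Relation.Unary.Any using (here)
open import Data.List.Relation.Unary.All using ([])
open import Data.List.Relation.Unary.AllPairs using ([]; _∷_)
open import Data.List.Relation.Unary.Unique.Propositional using (Unique)
import Data.List.Relation.Unary.Unique.Propositional.Properties as Unique
open import Data.List.Relation.Binary.BagAndSetEquality using (∼bag⇒↭)
open import Data.List.Relation.Binary.Permutation.Propositional.Properties using (↭-length)
open import Function.Bundles using (_⇔_; mk⇔)
import Function.Properties.Equivalence as ⇔
open import Function using (_∘_)
open import Relation.Binary.PropositionalEquality
open import Algebra.Bundles using (CommutativeRing)
open import Algebra.Properties.CommutativeSemigroup ℤP.+-commutativeSemigroup using (interchange)
import Algebra.Solver.Ring
import Relation.Binary.Reasoning.Setoid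
open import Algebra.Solver.Ring.AlmostCommutativeRing
  using (fromCommutativeRing; _-Raw-AlmostCommutative⟶_)
open import Relation.Nullary.Decidable using (dec⇒maybe)
import Data.Maybe

Σ≤-cong : ∀ n {h h′ : ℕ → ℤ} → (∀ i → i ≤ n → h i ≡ h′ i) → Σ≤ n h ≡ Σ≤ n h′
Σ≤-cong zero    e = e 0 z≤n
Σ≤-cong (suc n) e = cong₂ ℤ._+_ (Σ≤-cong n (λ i i≤n → e i (ℕP.m≤n⇒m≤1+n i≤n))) (e (suc n) ℕP.≤-refl)

Σ≤-distrib-+ : ∀ n (h h′ : ℕ → ℤ) → Σ≤ n (λ i → h i ℤ.+ h′ i) ≡ Σ≤ n h ℤ.+ Σ≤ n h′
Σ≤-distrib-+ zero    h h′ = refl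
Σ≤-distrib-+ (suc n) h h′ =
  trans (cong (ℤ._+ (h (suc n) ℤ.+ h′ (suc n))) (Σ≤-distrib-+ n h h′))
        (interchange (Σ≤ n h) (Σ≤ n h′) (h (suc n)) (h′ (suc n)))

*-distribˡ-Σ≤ : ∀ n c (h : ℕ → ℤ) → c ℤ.* Σ≤ n h ≡ Σ≤ n (λ i → c ℤ.* h i)
*-distribˡ-Σ≤ zero    c h = refl
*-distribˡ-Σ≤ (suc n) c h =
  trans (ℤP.*-distribˡ-+ c (Σ≤ n h) (h (suc n))) (cong (ℤ._+ c ℤ.* h (suc n)) (*-distribˡ-Σ≤ n c h))

*-distribʳ-Σ≤ : ∀ n c (h : ℕ → ℤ) → Σ≤ n h ℤ.* c ≡ Σ≤ n (λ i → h i ℤ.* c)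
*-distribʳ-Σ≤ zero    c h = refl
*-distribʳ-Σ≤ (suc n) c h =
  trans (ℤP.*-distribʳ-+ c (Σ≤ n h) (h (suc n))) (cong (ℤ._+ h (suc n) ℤ.* c) (*-distribʳ-Σ≤ n c h))

Σ≤-zero : ∀ n (h : ℕ → ℤ) → (∀ i → h i ≡ 0ℤ) → Σ≤ n h ≡ 0ℤ
Σ≤-zero zero    h h≡0 = h≡0 0
Σ≤-zero (suc n) h h≡0 = cong₂ ℤ._+_ (Σ≤-zero n h h≡0) (h≡0 (suc n))

Σ≤-suc : ∀ n (h : ℕ → ℤ) → Σ≤ (suc n) h ≡ h 0 ℤ.+ Σ≤ n (h ∘ suc)
Σ≤-suc zero    h = refl
Σ≤-suc (suc n) h =
  trans (cong (ℤ._+ h (suc (suc n))) (Σ≤-suc n h)) (ℤP.+-assoc (h 0) (Σ≤ n (h ∘ suc)) (h (suc (suc n))))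

Σ≤-reverse : ∀ n (h : ℕ → ℤ) → Σ≤ n h ≡ Σ≤ n (λ i → h (n ∸ i))
Σ≤-reverse zero    h = refl
Σ≤-reverse (suc n) h = begin
  Σ≤ (suc n) h                          ≡⟨ Σ≤-suc n h ⟩
  h 0 ℤ.+ Σ≤ n (h ∘ suc)                ≡⟨ ℤP.+-comm (h 0) _ ⟩
  Σ≤ n (h ∘ suc) ℤ.+ h 0                ≡⟨ cong (ℤ._+ h 0) (Σ≤-reverse n (h ∘ suc)) ⟩
  Σ≤ n (λ i → h (suc (n ∸ i))) ℤ.+ h 0  ≡⟨ cong₂ ℤ._+_ (Σ≤-cong n (λ i i≤n → cong h (sym (ℕP.+-∸-assoc 1 i≤n))))
                                                        (cong h (sym (ℕP.n∸n≡0 n))) ⟩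
  Σ≤ (suc n) (λ i → h (suc n ∸ i))      ∎
  where open ≡-Reasoning

Σ≤-triangle : ∀ n (h : ℕ → ℕ → ℤ) →
  Σ≤ n (λ m → Σ≤ m (λ i → h i m)) ≡ Σ≤ n (λ i → Σ≤ (n ∸ i) (λ j → h i (i ℕ.+ j)))
Σ≤-triangle zero    h = refl
Σ≤-triangle (suc n) h = begin
  Σ≤ n (λ m → Σ≤ m (λ i → h i m)) ℤ.+ (Σ≤ n (λ i → h i (suc n)) ℤ.+ h (suc n) (suc n))
    ≡⟨ cong (ℤ._+ (Σ≤ n (λ i → h i (suc n)) ℤ.+ h (suc n) (suc n))) (Σ≤-triangle n h) ⟩
  column n ℤ.+ (Σ≤ n (λ i → h i (suc n)) ℤ.+ h (suc n) (suc n))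
    ≡⟨ sym (ℤP.+-assoc (column n) _ _) ⟩
  (column n ℤ.+ Σ≤ n (λ i → h i (suc n))) ℤ.+ h (suc n) (suc n)
    ≡⟨ cong (ℤ._+ h (suc n) (suc n)) (sym (Σ≤-distrib-+ n _ _)) ⟩
  Σ≤ n (λ i → Σ≤ (n ∸ i) (λ j → h i (i ℕ.+ j)) ℤ.+ h i (suc n)) ℤ.+ h (suc n) (suc n)
    ≡⟨ cong₂ ℤ._+_ (Σ≤-cong n extend-row) (trans (cong (h (suc n)) (sym (ℕP.+-identityʳ (suc n))))
                                                      (cong (λ d → Σ≤ d (λ j → h (suc n) (suc n ℕ.+ j)))
                                                            (sym (ℕP.n∸n≡0 n)))) ⟩
  Σ≤ n (λ i → Σ≤ (suc n ∸ i) (λ j → h i (i ℕ.+ j))) ℤ.+ Σ≤ (suc n ∸ suc n) (λ j → h (suc n) (suc n ℕ.+ j))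
    ∎
  where
  open ≡-Reasoning
  column : ℕ → ℤ
  column n = Σ≤ n (λ i → Σ≤ (n ∸ i) (λ j → h i (i ℕ.+ j)))
  extend-row : ∀ i → i ≤ n →
    Σ≤ (n ∸ i) (λ j → h i (i ℕ.+ j)) ℤ.+ h i (suc n) ≡ Σ≤ (suc n ∸ i) (λ j → h i (i ℕ.+ j))
  extend-row i i≤n rewrite ℕP.+-∸-assoc 1 i≤n =
    cong (λ m → Σ≤ (n ∸ i) (λ j → h i (i ℕ.+ j)) ℤ.+ h i m)
         (sym (trans (ℕP.+-suc i (n ∸ i)) (cong suc (ℕP.m+[n∸m]≡n i≤n))))

C-zero : ∀ n → C 0ℤ n ≡ 0ℤ
C-zero zero    = refl
C-zero (suc n) = refl

⊛-cong : ∀ {a a′ b b′} → a ≈ a′ → b ≈ b′ → a ⊛ b ≈ a′ ⊛ b′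
⊛-cong a≈a′ b≈b′ n = Σ≤-cong n (λ i _ → cong₂ ℤ._*_ (a≈a′ i) (b≈b′ (n ∸ i)))

⊛-congˡ : ∀ a {b b′} → b ≈ b′ → a ⊛ b ≈ a ⊛ b′
⊛-congˡ a = ⊛-cong {a} (λ _ → refl)

⊛-congʳ : ∀ {a a′} b → a ≈ a′ → a ⊛ b ≈ a′ ⊛ b
⊛-congʳ b a≈a′ = ⊛-cong {b = b} a≈a′ (λ _ → refl)

⊛-comm : ∀ a b → a ⊛ b ≈ b ⊛ a
⊛-comm a b n = trans (Σ≤-reverse n _) (Σ≤-cong n λ i i≤n →
  trans (cong (λ m → a (n ∸ i) ℤ.* b m) (ℕP.m∸[m∸n]≡n i≤n)) (ℤP.*-comm (a (n ∸ i)) (b i)))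

⊛-assoc : ∀ a b c → (a ⊛ b) ⊛ c ≈ a ⊛ (b ⊛ c)
⊛-assoc a b c n = begin
  Σ≤ n (λ m → Σ≤ m (λ i → a i ℤ.* b (m ∸ i)) ℤ.* c (n ∸ m))
    ≡⟨ Σ≤-cong n (λ m _ → *-distribʳ-Σ≤ m (c (n ∸ m)) _) ⟩
  Σ≤ n (λ m → Σ≤ m (λ i → a i ℤ.* b (m ∸ i) ℤ.* c (n ∸ m)))
    ≡⟨ Σ≤-triangle n (λ i m → a i ℤ.* b (m ∸ i) ℤ.* c (n ∸ m)) ⟩
  Σ≤ n (λ i → Σ≤ (n ∸ i) (λ j → a i ℤ.* b (i ℕ.+ j ∸ i) ℤ.* c (n ∸ (i ℕ.+ j))))
    ≡⟨ Σ≤-cong n (λ i _ → Σ≤-cong (n ∸ i) (λ j _ → reindex i j)) ⟩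
  Σ≤ n (λ i → Σ≤ (n ∸ i) (λ j → a i ℤ.* (b j ℤ.* c (n ∸ i ∸ j))))
    ≡⟨ Σ≤-cong n (λ i _ → sym (*-distribˡ-Σ≤ (n ∸ i) (a i) _)) ⟩
  Σ≤ n (λ i → a i ℤ.* Σ≤ (n ∸ i) (λ j → b j ℤ.* c (n ∸ i ∸ j)))
    ∎
  where
  open ≡-Reasoning
  reindex : ∀ i j → a i ℤ.* b (i ℕ.+ j ∸ i) ℤ.* c (n ∸ (i ℕ.+ j)) ≡ a i ℤ.* (b j ℤ.* c (n ∸ i ∸ j))
  reindex i j rewrite ℕP.m+n∸m≡n i j | ℕP.∸-+-assoc n i j = ℤP.*-assoc (a i) (b j) _

⊛-distribˡ-⊕ : ∀ a b c → a ⊛ (b ⊕ c) ≈ a ⊛ b ⊕ a ⊛ c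
⊛-distribˡ-⊕ a b c n =
  trans (Σ≤-cong n (λ i _ → ℤP.*-distribˡ-+ (a i) (b (n ∸ i)) (c (n ∸ i)))) (Σ≤-distrib-+ n _ _)

C-⊛ : ∀ c a n → (C c ⊛ a) n ≡ c ℤ.* a n
C-⊛ c a zero    = refl
C-⊛ c a (suc n) = trans (Σ≤-suc n _) (trans
  (cong (ℤ._+_ (c ℤ.* a (suc n))) (Σ≤-zero n _ (λ i → ℤP.*-zeroˡ (a (n ∸ i)))))
  (ℤP.+-identityʳ _))

⊛-identityˡ : ∀ a → C 1ℤ ⊛ a ≈ a
⊛-identityˡ a n = trans (C-⊛ 1ℤ a n) (ℤP.*-identityˡ (a n))

⊕-identityˡ : ∀ a → C 0ℤ ⊕ a ≈ a
⊕-identityˡ a n = trans (cong (ℤ._+ a n) (C-zero n)) (ℤP.+-identityˡ (a n))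

serCommutativeRing : CommutativeRing _ _
serCommutativeRing = record
  { Carrier = Ser ; _≈_ = _≈_ ; _+_ = _⊕_ ; _*_ = _⊛_ ; -_ = λ a n → ℤ.- a n ; 0# = C 0ℤ ; 1# = C 1ℤ
  ; isCommutativeRing = record
    { isRing = record
      { +-isAbelianGroup = record
        { isGroup = record
          { isMonoid = record
            { isSemigroup = record
              { isMagma = record
                { isEquivalence = record
                  { refl = λ _ → refl ; sym = λ e n → sym (e n) ; trans = λ e e′ n → trans (e n) (e′ n) }
                ; ∙-cong = λ e e′ n → cong₂ ℤ._+_ (e n) (e′ n) }
              ; assoc = λ a b c n → ℤP.+-assoc (a n) (b n) (c n) }
            ; identity = ⊕-identityˡ , λ a n → trans (ℤP.+-comm (a n) _) (⊕-identityˡ a n) }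
          ; inverse = (λ a n → trans (ℤP.+-inverseˡ (a n)) (sym (C-zero n)))
                    , (λ a n → trans (ℤP.+-inverseʳ (a n)) (sym (C-zero n)))
          ; ⁻¹-cong = λ e n → cong ℤ.-_ (e n) }
        ; comm = λ a b n → ℤP.+-comm (a n) (b n) }
      ; *-cong = ⊛-cong
      ; *-assoc = ⊛-assoc
      ; *-identity = ⊛-identityˡ , λ a n → trans (⊛-comm a (C 1ℤ) n) (⊛-identityˡ a n)
      ; distrib = ⊛-distribˡ-⊕ , λ a b c n → trans (⊛-comm (b ⊕ c) a n)
                    (trans (⊛-distribˡ-⊕ a b c n) (cong₂ ℤ._+_ (⊛-comm a b n) (⊛-comm a c n)))
      }
    ; *-comm = ⊛-comm } }

C-homomorphism : ℤ.+-*-rawRing -Raw-AlmostCommutative⟶ fromCommutativeRing serCommutativeRing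
C-homomorphism = record
  { ⟦_⟧    = C
  ; +-homo = λ a b → λ { zero → refl ; (suc n) → refl }
  ; *-homo = λ a b n → sym (trans (C-⊛ a (C b) n) (scale a b n))
  ; -‿homo = λ a → λ { zero → refl ; (suc n) → refl }
  ; 0-homo = λ { zero → refl ; (suc n) → refl }
  ; 1-homo = λ { zero → refl ; (suc n) → refl } }
  where
  scale : ∀ a b n → a ℤ.* C b n ≡ C (a ℤ.* b) n
  scale a b zero    = refl
  scale a b (suc n) = ℤP.*-zeroʳ a

open Algebra.Solver.Ring ℤ.+-*-rawRing (fromCommutativeRing serCommutativeRing) C-homomorphism
  (λ a b → Data.Maybe.map (λ a≡b n → cong (λ c → C c n) a≡b) (dec⇒maybe (a ℤP.≟ b)))
  using (solve; _:=_; _:+_; _:*_; _:-_; :-_; con; Polynomial)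

open CommutativeRing serCommutativeRing using ()
  renaming (refl to ≈-refl; sym to ≈-sym; trans to ≈-trans; +-congˡ to ⊕-congˡ; +-congʳ to ⊕-congʳ;
            +-cong to ⊕-cong; +-identityʳ to ⊕-identityʳ; zeroˡ to ⊛-zeroˡ; zeroʳ to ⊛-zeroʳ;
            -‿inverseʳ to ⊖-inverseʳ; -_ to neg)
module ≈-Reasoning = Relation.Binary.Reasoning.Setoid (CommutativeRing.setoid serCommutativeRing)

Z⊛-zero : ∀ a → (Z ⊛ a) 0 ≡ 0ℤ
Z⊛-zero a = ℤP.*-zeroˡ (a 0)

Z⊛-suc : ∀ a n → (Z ⊛ a) (suc n) ≡ a n
Z⊛-suc a n = trans (Σ≤-suc n _) (trans (cong₂ ℤ._+_ (ℤP.*-zeroˡ (a (suc n))) (shifted n)) (ℤP.+-identityˡ (a n)))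
  where
  shifted : ∀ n → Σ≤ n (λ i → Z (suc i) ℤ.* a (n ∸ i)) ≡ a n
  shifted zero    = ℤP.*-identityˡ (a 0)
  shifted (suc m) = trans (Σ≤-suc m _) (trans
    (cong₂ ℤ._+_ (ℤP.*-identityˡ (a (suc m))) (Σ≤-zero m _ (λ i → ℤP.*-zeroˡ (a (m ∸ i)))))
    (ℤP.+-identityʳ (a (suc m))))

≈-Z⊛ : ∀ {a b} → a 0 ≡ 0ℤ → (∀ n → a (suc n) ≡ b n) → a ≈ Z ⊛ b
≈-Z⊛ {b = b} a₀≡0 a₁₊≡b zero    = trans a₀≡0 (sym (Z⊛-zero b))
≈-Z⊛ {b = b} a₀≡0 a₁₊≡b (suc n) = trans (a₁₊≡b n) (sym (Z⊛-suc b n))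

Z⊛-cancel : ∀ {a b} → Z ⊛ a ≈ Z ⊛ b → a ≈ b
Z⊛-cancel {a} {b} e n = trans (sym (Z⊛-suc a n)) (trans (e (suc n)) (Z⊛-suc b n))

C⊛-cancel : ∀ c .{{_ : ℤ.NonZero c}} {a b} → C c ⊛ a ≈ C c ⊛ b → a ≈ b
C⊛-cancel c {a} {b} e n = ℤP.*-cancelˡ-≡ c (a n) (b n) (trans (sym (C-⊛ c a n)) (trans (e n) (C-⊛ c b n)))

[1+_]² : Ser → Ser
[1+ r ]² = (C 1ℤ ⊕ r) ⊛ (C 1ℤ ⊕ r)

[1+_]²ₚ : ∀ {n} → Polynomial n → Polynomial n
[1+ r ]²ₚ = (con 1ℤ :+ r) :* (con 1ℤ :+ r)

defectₚ : ∀ {n} → Polynomial n → Polynomial n → Polynomial n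
defectₚ r z = z :* z :* [1+ r ]²ₚ :- r

-- Squaring 2z²r = 1 - 2z² - s gives 4z²·(z²(1+r)² - r) = s² - (1 - 4z²) = 0.
quadratic-equation : ∀ r s → s ⊛ s ≈ C 1ℤ ⊖ C (+ 4) ⊛ Z ⊛ Z → C (+ 2) ⊛ Z ⊛ Z ⊛ r ≈ C 1ℤ ⊖ C (+ 2) ⊛ Z ⊛ Z ⊖ s →
  Z ⊛ Z ⊛ [1+ r ]² ≈ r
quadratic-equation r s s² 2z²r = Z⊛-cancel (Z⊛-cancel (C⊛-cancel (+ 4) (begin
  C (+ 4) ⊛ (Z ⊛ (Z ⊛ (Z ⊛ Z ⊛ [1+ r ]²)))
    ≈⟨ solve 2 (λ r z → con (+ 4) :* (z :* (z :* (z :* z :* [1+ r ]²ₚ)))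
                     := tₚ r z :* tₚ r z :- one-4z² z :+ con (+ 4) :* (z :* (z :* r)))
               (λ _ → refl) r Z ⟩
  t ⊛ t ⊖ (C 1ℤ ⊖ C (+ 4) ⊛ Z ⊛ Z) ⊕ C (+ 4) ⊛ (Z ⊛ (Z ⊛ r))
    ≈⟨ (λ n → cong (λ x → x ℤ.- (C 1ℤ ⊖ C (+ 4) ⊛ Z ⊛ Z) n ℤ.+ (C (+ 4) ⊛ (Z ⊛ (Z ⊛ r))) n)
                   (trans (⊛-cong (≈-sym s≈t) (≈-sym s≈t) n) (s² n))) ⟩
  (C 1ℤ ⊖ C (+ 4) ⊛ Z ⊛ Z) ⊖ (C 1ℤ ⊖ C (+ 4) ⊛ Z ⊛ Z) ⊕ C (+ 4) ⊛ (Z ⊛ (Z ⊛ r))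
    ≈⟨ solve 2 (λ x y → x :- x :+ y := y) (λ _ → refl) (C 1ℤ ⊖ C (+ 4) ⊛ Z ⊛ Z) _ ⟩
  C (+ 4) ⊛ (Z ⊛ (Z ⊛ r))
    ∎)))
  where
  open ≈-Reasoning
  one-4z² : ∀ {n} → Polynomial n → Polynomial n
  one-4z² z = con 1ℤ :- con (+ 4) :* z :* z
  tₚ : ∀ {n} → Polynomial n → Polynomial n → Polynomial n
  tₚ r z = con 1ℤ :- con (+ 2) :* z :* z :- con (+ 2) :* z :* z :* r
  t : Ser
  t = C 1ℤ ⊖ C (+ 2) ⊛ Z ⊛ Z ⊖ C (+ 2) ⊛ Z ⊛ Z ⊛ r
  s≈t : s ≈ t
  s≈t = begin
    s
      ≈⟨ solve 2 (λ s z → s := con 1ℤ :- con (+ 2) :* z :* z :- (con 1ℤ :- con (+ 2) :* z :* z :- s))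
               (λ _ → refl) s Z ⟩
    C 1ℤ ⊖ C (+ 2) ⊛ Z ⊛ Z ⊖ (C 1ℤ ⊖ C (+ 2) ⊛ Z ⊛ Z ⊖ s)
      ≈⟨ (λ n → cong (ℤ._-_ ((C 1ℤ ⊖ C (+ 2) ⊛ Z ⊛ Z) n)) (sym (2z²r n))) ⟩
    t ∎

-- Transfer equations; P k and Q k stand for the paper's f_k and g_k

-- paths an up-step may follow: those ending with a down-step, and the empty path at height 0
ready : (ℕ → Ser) → ℕ → Ser
ready Q zero    = Q zero ⊕ C 1ℤ
ready Q (suc h) = Q (suc h)

-- an up-step reaches height k + 1 by E from height k or by N from height k - 1
upSources : (ℕ → Ser) → ℕ → Ser
upSources Q zero    = ready Q 0
upSources Q (suc k) = ready Q (suc k) ⊕ ready Q k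

record Transfer (P Q : ℕ → Ser) : Set where
  field
    up-zero : P 0 ≈ C 1ℤ
    up-suc  : ∀ k → P (suc k) ≈ Z ⊛ upSources Q k
    down    : ∀ k → Q k ≈ Z ⊛ (P (suc k) ⊕ P (suc (suc k)))

Z⊛-coeff-zero : ∀ {A B} a b → A ≈ Z ⊛ a → B ≈ Z ⊛ b → A 0 ≡ B 0
Z⊛-coeff-zero a b A≈ B≈ = trans (A≈ 0) (trans (Z⊛-zero a) (sym (trans (B≈ 0) (Z⊛-zero b))))

Z⊛-coeff-suc : ∀ {A B} a b n → A ≈ Z ⊛ a → B ≈ Z ⊛ b → a n ≡ b n → A (suc n) ≡ B (suc n)
Z⊛-coeff-suc a b n A≈ B≈ aₙ≡bₙ =
  trans (A≈ (suc n)) (trans (Z⊛-suc a n) (trans aₙ≡bₙ (sym (trans (B≈ (suc n)) (Z⊛-suc b n)))))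

transfer-unique : ∀ {P Q P′ Q′} → Transfer P Q → Transfer P′ Q′ → (∀ k → P k ≈ P′ k) × (∀ k → Q k ≈ Q′ k)
transfer-unique {P} {Q} {P′} {Q′} T T′ = (λ k n → up n k) , (λ k n → down n k)
  where
  module T = Transfer T
  module T′ = Transfer T′
  mutual
    up : ∀ n k → P k n ≡ P′ k n
    up n       zero    = trans (T.up-zero n) (sym (T′.up-zero n))
    up zero    (suc k) = Z⊛-coeff-zero (upSources Q k) (upSources Q′ k) (T.up-suc k) (T′.up-suc k)
    up (suc n) (suc k) = Z⊛-coeff-suc (upSources Q k) (upSources Q′ k) n (T.up-suc k) (T′.up-suc k) (sources n k)

    sources : ∀ n k → upSources Q k n ≡ upSources Q′ k n
    sources n zero    = ready′ n 0
    sources n (suc k) = cong₂ ℤ._+_ (ready′ n (suc k)) (ready′ n k)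

    ready′ : ∀ n h → ready Q h n ≡ ready Q′ h n
    ready′ n zero    = cong (ℤ._+ C 1ℤ n) (down n 0)
    ready′ n (suc h) = down n (suc h)

    down : ∀ n k → Q k n ≡ Q′ k n
    down zero    k = Z⊛-coeff-zero (P (suc k) ⊕ P (suc (suc k))) (P′ (suc k) ⊕ P′ (suc (suc k))) (T.down k) (T′.down k)
    down (suc n) k = Z⊛-coeff-suc (P (suc k) ⊕ P (suc (suc k))) (P′ (suc k) ⊕ P′ (suc (suc k))) n
                       (T.down k) (T′.down k) (cong₂ ℤ._+_ (up n (suc k)) (up n (suc (suc k))))

-- Polynomials in u of low degree

record Linear (L : BSer) (a b : Ser) : Set where
  field
    coeff₀  : L 0 ≈ a
    coeff₁  : L 1 ≈ b
    coeff₂₊ : ∀ j → L (2 ℕ.+ j) ≈ C 0ℤ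

record Quadratic (Q : BSer) (a b c : Ser) : Set where
  field
    coeff₀  : Q 0 ≈ a
    coeff₁  : Q 1 ≈ b
    coeff₂  : Q 2 ≈ c
    coeff₃₊ : ∀ j → Q (3 ℕ.+ j) ≈ C 0ℤ

Quadratic-unique : ∀ {Q Q′ a b c} → Quadratic Q a b c → Quadratic Q′ a b c → Q ≈ᵇ Q′
Quadratic-unique q q′ zero                = ≈-trans (Quadratic.coeff₀ q) (≈-sym (Quadratic.coeff₀ q′))
Quadratic-unique q q′ (suc zero)          = ≈-trans (Quadratic.coeff₁ q) (≈-sym (Quadratic.coeff₁ q′))
Quadratic-unique q q′ (suc (suc zero))    = ≈-trans (Quadratic.coeff₂ q) (≈-sym (Quadratic.coeff₂ q′))
Quadratic-unique q q′ (suc (suc (suc j))) = ≈-trans (Quadratic.coeff₃₊ q j) (≈-sym (Quadratic.coeff₃₊ q′ j))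

module _ {L a b} (lin : Linear L a b) (B : BSer) where
  open Linear lin

  ⊛ᵇ-coeff-zero : (L ⊛ᵇ B) 0 ≈ a ⊛ B 0
  ⊛ᵇ-coeff-zero = ⊛-congʳ (B 0) coeff₀

  ⊛ᵇ-coeff-suc : ∀ k → (L ⊛ᵇ B) (suc k) ≈ a ⊛ B (suc k) ⊕ b ⊛ B k
  ⊛ᵇ-coeff-suc k = ≈-trans (two-terms k) (⊕-cong (⊛-congʳ (B (suc k)) coeff₀) (⊛-congʳ (B k) coeff₁))
    where
    vanish : ∀ k j n → (L (2 ℕ.+ j) ⊛ B (k ∸ j)) n ≡ 0ℤ
    vanish k j n = trans (⊛-congʳ (B (k ∸ j)) (coeff₂₊ j) n) (trans (⊛-zeroˡ (B (k ∸ j)) n) (C-zero n))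
    two-terms : ∀ k → (L ⊛ᵇ B) (suc k) ≈ L 0 ⊛ B (suc k) ⊕ L 1 ⊛ B k
    two-terms zero    n = refl
    two-terms (suc k) n = trans (Σ≤-suc (suc k) _) (cong (ℤ._+_ ((L 0 ⊛ B (suc (suc k))) n))
      (trans (Σ≤-suc k _) (trans (cong (ℤ._+_ ((L 1 ⊛ B (suc k)) n)) (Σ≤-zero k _ (λ j → vanish k j n)))
                                 (ℤP.+-identityʳ _))))

Linear-ι : ∀ a → Linear (ι a) a (C 0ℤ)
Linear-ι a = record { coeff₀ = ≈-refl ; coeff₁ = ≈-refl ; coeff₂₊ = λ _ → ≈-refl }

Linear-U : Linear U (C 0ℤ) (C 1ℤ)
Linear-U = record { coeff₀ = ≈-refl ; coeff₁ = ≈-refl ; coeff₂₊ = λ _ → ≈-refl }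

Linear-⊕ᵇ : ∀ {L L′ a b a′ b′} → Linear L a b → Linear L′ a′ b′ → Linear (L ⊕ᵇ L′) (a ⊕ a′) (b ⊕ b′)
Linear-⊕ᵇ l l′ = record
  { coeff₀  = ⊕-cong (Linear.coeff₀ l) (Linear.coeff₀ l′)
  ; coeff₁  = ⊕-cong (Linear.coeff₁ l) (Linear.coeff₁ l′)
  ; coeff₂₊ = λ j → ≈-trans (⊕-cong (Linear.coeff₂₊ l j) (Linear.coeff₂₊ l′ j)) (⊕-identityʳ (C 0ℤ)) }

Linear-⊖ᵇ : ∀ {L L′ a b a′ b′} → Linear L a b → Linear L′ a′ b′ → Linear (L ⊖ᵇ L′) (a ⊖ a′) (b ⊖ b′)
Linear-⊖ᵇ l l′ = record
  { coeff₀  = λ n → cong₂ ℤ._-_ (Linear.coeff₀ l n) (Linear.coeff₀ l′ n)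
  ; coeff₁  = λ n → cong₂ ℤ._-_ (Linear.coeff₁ l n) (Linear.coeff₁ l′ n)
  ; coeff₂₊ = λ j → ≈-trans (λ n → cong₂ ℤ._-_ (Linear.coeff₂₊ l j n) (Linear.coeff₂₊ l′ j n))
                            (⊖-inverseʳ (C 0ℤ)) }

Linear-⊛ᵇ-quadratic : ∀ {L L′ a b a′ b′} → Linear L a b → Linear L′ a′ b′ →
  Quadratic (L ⊛ᵇ L′) (a ⊛ a′) (a ⊛ b′ ⊕ b ⊛ a′) (b ⊛ b′)
Linear-⊛ᵇ-quadratic {L} {L′} {a} {b} {a′} {b′} l l′ = record
  { coeff₀  = ≈-trans (⊛ᵇ-coeff-zero l L′) (⊛-congˡ a (coeff₀ l′))
  ; coeff₁  = ≈-trans (⊛ᵇ-coeff-suc l L′ 0) (⊕-cong (⊛-congˡ a (coeff₁ l′)) (⊛-congˡ b (coeff₀ l′)))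
  ; coeff₂  = ≈-trans (⊛ᵇ-coeff-suc l L′ 1)
                (≈-trans (⊕-cong (⊛-congˡ a (coeff₂₊ l′ 0)) (⊛-congˡ b (coeff₁ l′)))
                         (solve 2 (λ a c → a :* con 0ℤ :+ c := c) (λ _ → refl) a (b ⊛ b′)))
  ; coeff₃₊ = λ j → ≈-trans (⊛ᵇ-coeff-suc l L′ (2 ℕ.+ j))
                (≈-trans (⊕-cong (⊛-congˡ a (coeff₂₊ l′ (1 ℕ.+ j))) (⊛-congˡ b (coeff₂₊ l′ j)))
                         (solve 2 (λ a b → a :* con 0ℤ :+ b :* con 0ℤ := con 0ℤ) (λ _ → refl) a b)) }
  where open Linear

Linear-resp : ∀ {L a b a′ b′} → Linear L a b → a ≈ a′ → b ≈ b′ → Linear L a′ b′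
Linear-resp l a≈ b≈ = record { coeff₀ = ≈-trans coeff₀ a≈ ; coeff₁ = ≈-trans coeff₁ b≈ ; coeff₂₊ = coeff₂₊ }
  where open Linear l

Quadratic⇒Linear : ∀ {Q a b c} → Quadratic Q a b c → c ≈ C 0ℤ → Linear Q a b
Quadratic⇒Linear q c≈0 = record
  { coeff₀ = coeff₀ ; coeff₁ = coeff₁
  ; coeff₂₊ = λ { zero → ≈-trans coeff₂ c≈0 ; (suc j) → coeff₃₊ j } }
  where open Quadratic q

Linear⇒Quadratic : ∀ {L a b} → Linear L a b → Quadratic L a b (C 0ℤ)
Linear⇒Quadratic l = record
  { coeff₀ = coeff₀ ; coeff₁ = coeff₁ ; coeff₂ = coeff₂₊ 0 ; coeff₃₊ = λ j → coeff₂₊ (suc j) }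
  where open Linear l

Quadratic-⊕ᵇ : ∀ {Q Q′ a b c a′ b′ c′} → Quadratic Q a b c → Quadratic Q′ a′ b′ c′ →
  Quadratic (Q ⊕ᵇ Q′) (a ⊕ a′) (b ⊕ b′) (c ⊕ c′)
Quadratic-⊕ᵇ q q′ = record
  { coeff₀  = ⊕-cong (coeff₀ q) (coeff₀ q′)
  ; coeff₁  = ⊕-cong (coeff₁ q) (coeff₁ q′)
  ; coeff₂  = ⊕-cong (coeff₂ q) (coeff₂ q′)
  ; coeff₃₊ = λ j → ≈-trans (⊕-cong (coeff₃₊ q j) (coeff₃₊ q′ j)) (⊕-identityʳ (C 0ℤ)) }
  where open Quadratic

Quadratic-resp : ∀ {Q a b c a′ b′ c′} → Quadratic Q a b c → a ≈ a′ → b ≈ b′ → c ≈ c′ → Quadratic Q a′ b′ c′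
Quadratic-resp q a≈ b≈ c≈ = record
  { coeff₀ = ≈-trans coeff₀ a≈ ; coeff₁ = ≈-trans coeff₁ b≈ ; coeff₂ = ≈-trans coeff₂ c≈ ; coeff₃₊ = coeff₃₊ }
  where open Quadratic q

≈ᵇ-trans : ∀ {A B D} → A ≈ᵇ B → B ≈ᵇ D → A ≈ᵇ D
≈ᵇ-trans A≈B B≈D k n = trans (A≈B k n) (B≈D k n)

⊛ᵇ-congʳ : ∀ A {B B′} → B ≈ᵇ B′ → A ⊛ᵇ B ≈ᵇ A ⊛ᵇ B′
⊛ᵇ-congʳ A B≈B′ k n = Σ≤-cong k (λ j _ → ⊛-congˡ (A j) (B≈B′ (k ∸ j)) n)

module _ (r : Ser) where

  ru-linear : Linear (ι r ⊛ᵇ U) (C 0ℤ) r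
  ru-linear = Linear-resp (Quadratic⇒Linear (Linear-⊛ᵇ-quadratic (Linear-ι r) Linear-U) (⊛-zeroˡ (C 1ℤ)))
    (⊛-zeroʳ r) (solve 1 (λ r → r :* con 1ℤ :+ con 0ℤ :* con 0ℤ := r) (λ _ → refl) r)

  ur-linear : Linear (U ⊛ᵇ ι r) (C 0ℤ) r
  ur-linear = Linear-resp (Quadratic⇒Linear (Linear-⊛ᵇ-quadratic Linear-U (Linear-ι r)) (⊛-zeroʳ (C 1ℤ)))
    (⊛-zeroˡ r) (solve 1 (λ r → con 0ℤ :* con 0ℤ :+ con 1ℤ :* r := r) (λ _ → refl) r)

  1-ru-linear : Linear (ι (C 1ℤ) ⊖ᵇ ι r ⊛ᵇ U) (C 1ℤ) (neg r)
  1-ru-linear = Linear-resp (Linear-⊖ᵇ (Linear-ι (C 1ℤ)) ru-linear)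
    (solve 0 (con 1ℤ :- con 0ℤ := con 1ℤ) (λ _ → refl)) (solve 1 (λ r → con 0ℤ :- r := :- r) (λ _ → refl) r)

  z[1-ru]-linear : Linear (ι Z ⊛ᵇ (ι (C 1ℤ) ⊖ᵇ ι r ⊛ᵇ U)) Z (neg (Z ⊛ r))
  z[1-ru]-linear = Linear-resp (Quadratic⇒Linear (Linear-⊛ᵇ-quadratic (Linear-ι Z) 1-ru-linear) (⊛-zeroˡ (neg r)))
    (solve 1 (λ z → z :* con 1ℤ := z) (λ _ → refl) Z)
    (solve 2 (λ z r → z :* (:- r) :+ con 0ℤ :* con 1ℤ := :- (z :* r)) (λ _ → refl) Z r)

  F-rhs-quadratic : Quadratic (ι r ⊛ᵇ U ⊛ᵇ U ⊕ᵇ U ⊛ᵇ ι r ⊛ᵇ ι (C 1ℤ ⊖ Z) ⊕ᵇ ι Z) Z (r ⊛ (C 1ℤ ⊖ Z)) r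
  F-rhs-quadratic = Quadratic-resp
    (Quadratic-⊕ᵇ (Quadratic-⊕ᵇ (Linear-⊛ᵇ-quadratic ru-linear Linear-U)
                                (Linear-⊛ᵇ-quadratic ur-linear (Linear-ι (C 1ℤ ⊖ Z))))
                  (Linear⇒Quadratic (Linear-ι Z)))
    (solve 1 (λ z → con 0ℤ :* con 0ℤ :+ con 0ℤ :* (con 1ℤ :- z) :+ z := z) (λ _ → refl) Z)
    (solve 2 (λ r z → con 0ℤ :* con 1ℤ :+ r :* con 0ℤ :+ (con 0ℤ :* con 0ℤ :+ r :* (con 1ℤ :- z)) :+ con 0ℤ
                    := r :* (con 1ℤ :- z)) (λ _ → refl) r Z)
    (solve 2 (λ r z → r :* con 1ℤ :+ r :* con 0ℤ :+ con 0ℤ := r) (λ _ → refl) r Z)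

  G-rhs-quadratic : Quadratic (ι r ⊛ᵇ (U ⊕ᵇ ι r ⊕ᵇ ι (C (+ 2)))) (r ⊛ (C (+ 2) ⊕ r)) r (C 0ℤ)
  G-rhs-quadratic = Quadratic-resp
    (Linear-⊛ᵇ-quadratic (Linear-ι r) (Linear-⊕ᵇ (Linear-⊕ᵇ Linear-U (Linear-ι r)) (Linear-ι (C (+ 2)))))
    (solve 1 (λ r → r :* (con 0ℤ :+ r :+ con (+ 2)) := r :* (con (+ 2) :+ r)) (λ _ → refl) r)
    (solve 1 (λ r → r :* (con 1ℤ :+ con 0ℤ :+ con 0ℤ) :+ con 0ℤ :* (con 0ℤ :+ r :+ con (+ 2)) := r) (λ _ → refl) r)
    (solve 0 (con 0ℤ :* (con 1ℤ :+ con 0ℤ :+ con 0ℤ) := con 0ℤ) (λ _ → refl))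

  FG-rhs-quadratic : Quadratic (ι (r ⊛ r ⊛ Z) ⊕ᵇ ι r ⊛ᵇ U ⊛ᵇ U ⊕ᵇ ι r ⊛ᵇ U ⊕ᵇ ι (C (+ 2) ⊛ r ⊛ Z) ⊕ᵇ ι Z)
                                (Z ⊛ [1+ r ]²) r r
  FG-rhs-quadratic = Quadratic-resp
    (Quadratic-⊕ᵇ (Quadratic-⊕ᵇ (Quadratic-⊕ᵇ (Quadratic-⊕ᵇ (Linear⇒Quadratic (Linear-ι (r ⊛ r ⊛ Z)))
                                                                (Linear-⊛ᵇ-quadratic ru-linear Linear-U))
                                                  (Linear⇒Quadratic ru-linear))
                                   (Linear⇒Quadratic (Linear-ι (C (+ 2) ⊛ r ⊛ Z))))
                  (Linear⇒Quadratic (Linear-ι Z)))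
    (solve 2 (λ r z → r :* r :* z :+ con 0ℤ :* con 0ℤ :+ con 0ℤ :+ con (+ 2) :* r :* z :+ z := z :* [1+ r ]²ₚ)
           (λ _ → refl) r Z)
    (solve 1 (λ r → con 0ℤ :+ (con 0ℤ :* con 1ℤ :+ r :* con 0ℤ) :+ r :+ con 0ℤ :+ con 0ℤ := r) (λ _ → refl) r)
    (solve 1 (λ r → con 0ℤ :+ r :* con 1ℤ :+ con 0ℤ :+ con 0ℤ :+ con 0ℤ := r) (λ _ → refl) r)

-- Closed forms: the paper's f_k = ((1+r) r^(k-1) - [k=1]) / z and g_k = r^(k+1) / z² (k ≥ 1),
-- with the divisions by z cleared using r = z²(1+r)²

F-closed : Ser → ℕ → Ser
F-closed r 0               = C 1ℤ
F-closed r 1               = Z ⊛ [1+ r ]²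
F-closed r (suc (suc k))   = (C 1ℤ ⊕ r) ⊛ Z ⊛ [1+ r ]² ⊛ r ^ₛ k

G-closed : Ser → ℕ → Ser
G-closed r 0       = r ⊛ (C (+ 2) ⊕ r)
G-closed r (suc k) = [1+ r ]² ⊛ r ^ₛ suc k

module _ {r : Ser} (r-eq : Z ⊛ Z ⊛ [1+ r ]² ≈ r) where

  -- lets the solver prove identities that only hold up to a multiple of the defect z²(1+r)² - r
  modulo-r : ∀ {a b} K → a ≈ b ⊕ K ⊛ (Z ⊛ Z ⊛ [1+ r ]² ⊖ r) → a ≈ b
  modulo-r {a} {b} K a≈ = ≈-trans a≈ (≈-trans (⊕-congˡ {b} (≈-trans (⊛-congˡ K defect≈0) (⊛-zeroʳ K)))
                                              (⊕-identityʳ b))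
    where
    defect≈0 : Z ⊛ Z ⊛ [1+ r ]² ⊖ r ≈ C 0ℤ
    defect≈0 = ≈-trans (⊕-congʳ r-eq) (⊖-inverseʳ r)

  closed-transfer : Transfer (F-closed r) (G-closed r)
  closed-transfer = record { up-zero = ≈-refl ; up-suc = up ; down = down }
    where
    up : ∀ k → F-closed r (suc k) ≈ Z ⊛ upSources (G-closed r) k
    up zero = solve 2 (λ r z → z :* [1+ r ]²ₚ := z :* (r :* (con (+ 2) :+ r) :+ con 1ℤ)) (λ _ → refl) r Z
    up (suc zero) =
      solve 2 (λ r z → (con 1ℤ :+ r) :* z :* [1+ r ]²ₚ :* con 1ℤ
                     := z :* ([1+ r ]²ₚ :* (r :* con 1ℤ) :+ (r :* (con (+ 2) :+ r) :+ con 1ℤ)))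
            (λ _ → refl) r Z
    up (suc (suc h)) =
      solve 3 (λ r z t → (con 1ℤ :+ r) :* z :* [1+ r ]²ₚ :* (r :* t)
                       := z :* ([1+ r ]²ₚ :* (r :* (r :* t)) :+ [1+ r ]²ₚ :* (r :* t)))
            (λ _ → refl) r Z (r ^ₛ h)
    down : ∀ k → G-closed r k ≈ Z ⊛ (F-closed r (suc k) ⊕ F-closed r (suc (suc k)))
    down zero = modulo-r (λ n → ℤ.- (C (+ 2) ⊕ r) n)
      (solve 2 (λ r z → r :* (con (+ 2) :+ r)
                      := z :* (z :* [1+ r ]²ₚ :+ (con 1ℤ :+ r) :* z :* [1+ r ]²ₚ :* con 1ℤ)
                         :+ (:- (con (+ 2) :+ r)) :* defectₚ r z)
             (λ _ → refl) r Z)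
    down (suc k) = modulo-r (λ n → ℤ.- ([1+ r ]² ⊛ r ^ₛ k) n)
      (solve 3 (λ r z t → [1+ r ]²ₚ :* (r :* t)
                        := z :* ((con 1ℤ :+ r) :* z :* [1+ r ]²ₚ :* t :+ (con 1ℤ :+ r) :* z :* [1+ r ]²ₚ :* (r :* t))
                           :+ (:- ([1+ r ]²ₚ :* t)) :* defectₚ r z)
             (λ _ → refl) r Z (r ^ₛ k))

  Z⊛F-closed : ∀ k → 1 ≤ k → Z ⊛ F-closed r k ≈ (C 1ℤ ⊕ r) ⊛ r ^ₛ (k ∸ 1) ⊖ C [ k ≡1]
  Z⊛F-closed (suc zero) _ = modulo-r (C 1ℤ)
    (solve 2 (λ r z → z :* (z :* [1+ r ]²ₚ) := (con 1ℤ :+ r) :* con 1ℤ :- con 1ℤ :+ con 1ℤ :* defectₚ r z)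
           (λ _ → refl) r Z)
  Z⊛F-closed (suc (suc k)) _ = modulo-r ((C 1ℤ ⊕ r) ⊛ r ^ₛ k)
    (solve 3 (λ r z t → z :* ((con 1ℤ :+ r) :* z :* [1+ r ]²ₚ :* t)
                      := (con 1ℤ :+ r) :* (r :* t) :- con 0ℤ :+ ((con 1ℤ :+ r) :* t) :* defectₚ r z)
           (λ _ → refl) r Z (r ^ₛ k))

  Z⊛Z⊛G-closed : ∀ k → 1 ≤ k → Z ⊛ Z ⊛ G-closed r k ≈ r ^ₛ suc k
  Z⊛Z⊛G-closed (suc k) _ = modulo-r (r ⊛ r ^ₛ k)
    (solve 3 (λ r z t → z :* z :* ([1+ r ]²ₚ :* (r :* t)) := r :* (r :* t) :+ (r :* t) :* defectₚ r z)
           (λ _ → refl) r Z (r ^ₛ k))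

  F-closed-generating : ι Z ⊛ᵇ (ι (C 1ℤ) ⊖ᵇ ι r ⊛ᵇ U) ⊛ᵇ F-closed r
                        ≈ᵇ ι r ⊛ᵇ U ⊛ᵇ U ⊕ᵇ U ⊛ᵇ ι r ⊛ᵇ ι (C 1ℤ ⊖ Z) ⊕ᵇ ι Z
  F-closed-generating = Quadratic-unique (record
    { coeff₀  = ≈-trans (⊛ᵇ-coeff-zero (z[1-ru]-linear r) (F-closed r)) (≈-trans (⊛-comm Z (C 1ℤ)) (⊛-identityˡ Z))
    ; coeff₁  = ≈-trans (⊛ᵇ-coeff-suc (z[1-ru]-linear r) (F-closed r) 0) (modulo-r (C 1ℤ)
                  (solve 2 (λ r z → z :* (z :* [1+ r ]²ₚ) :+ (:- (z :* r)) :* con 1ℤ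
                                  := r :* (con 1ℤ :- z) :+ con 1ℤ :* defectₚ r z) (λ _ → refl) r Z))
    ; coeff₂  = ≈-trans (⊛ᵇ-coeff-suc (z[1-ru]-linear r) (F-closed r) 1) (modulo-r (C 1ℤ)
                  (solve 2 (λ r z → z :* ((con 1ℤ :+ r) :* z :* [1+ r ]²ₚ :* con 1ℤ) :+ (:- (z :* r)) :* (z :* [1+ r ]²ₚ)
                                  := r :+ con 1ℤ :* defectₚ r z) (λ _ → refl) r Z))
    ; coeff₃₊ = λ j → ≈-trans (⊛ᵇ-coeff-suc (z[1-ru]-linear r) (F-closed r) (2 ℕ.+ j))
                  (solve 3 (λ r z t → z :* ((con 1ℤ :+ r) :* z :* [1+ r ]²ₚ :* (r :* t))
                                      :+ (:- (z :* r)) :* ((con 1ℤ :+ r) :* z :* [1+ r ]²ₚ :* t) := con 0ℤ)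
                         (λ _ → refl) r Z (r ^ₛ j)) })
    (F-rhs-quadratic r)

  G-closed-generating : (ι (C 1ℤ) ⊖ᵇ ι r ⊛ᵇ U) ⊛ᵇ G-closed r ≈ᵇ ι r ⊛ᵇ (U ⊕ᵇ ι r ⊕ᵇ ι (C (+ 2)))
  G-closed-generating = Quadratic-unique (record
    { coeff₀  = ≈-trans (⊛ᵇ-coeff-zero (1-ru-linear r) (G-closed r)) (⊛-identityˡ (G-closed r 0))
    ; coeff₁  = ≈-trans (⊛ᵇ-coeff-suc (1-ru-linear r) (G-closed r) 0)
                  (solve 1 (λ r → con 1ℤ :* ([1+ r ]²ₚ :* (r :* con 1ℤ)) :+ (:- r) :* (r :* (con (+ 2) :+ r)) := r)
                         (λ _ → refl) r)
    ; coeff₂  = ≈-trans (⊛ᵇ-coeff-suc (1-ru-linear r) (G-closed r) 1)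
                  (solve 1 (λ r → con 1ℤ :* ([1+ r ]²ₚ :* (r :* (r :* con 1ℤ))) :+ (:- r) :* ([1+ r ]²ₚ :* (r :* con 1ℤ))
                                := con 0ℤ) (λ _ → refl) r)
    ; coeff₃₊ = λ j → ≈-trans (⊛ᵇ-coeff-suc (1-ru-linear r) (G-closed r) (2 ℕ.+ j))
                  (solve 2 (λ r t → con 1ℤ :* ([1+ r ]²ₚ :* (r :* (r :* (r :* t)))) :+ (:- r) :* ([1+ r ]²ₚ :* (r :* (r :* t)))
                                  := con 0ℤ) (λ _ → refl) r (r ^ₛ j)) })
    (G-rhs-quadratic r)

  FG-closed-generating : ι Z ⊛ᵇ (ι (C 1ℤ) ⊖ᵇ ι r ⊛ᵇ U) ⊛ᵇ (F-closed r ⊕ᵇ G-closed r)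
    ≈ᵇ ι (r ⊛ r ⊛ Z) ⊕ᵇ ι r ⊛ᵇ U ⊛ᵇ U ⊕ᵇ ι r ⊛ᵇ U ⊕ᵇ ι (C (+ 2) ⊛ r ⊛ Z) ⊕ᵇ ι Z
  FG-closed-generating = Quadratic-unique (record
    { coeff₀  = ≈-trans (⊛ᵇ-coeff-zero (z[1-ru]-linear r) (F-closed r ⊕ᵇ G-closed r))
                  (solve 2 (λ r z → z :* (con 1ℤ :+ r :* (con (+ 2) :+ r)) := z :* [1+ r ]²ₚ) (λ _ → refl) r Z)
    ; coeff₁  = ≈-trans (⊛ᵇ-coeff-suc (z[1-ru]-linear r) (F-closed r ⊕ᵇ G-closed r) 0) (modulo-r (C 1ℤ)
                  (solve 2 (λ r z → z :* (z :* [1+ r ]²ₚ :+ [1+ r ]²ₚ :* (r :* con 1ℤ))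
                                    :+ (:- (z :* r)) :* (con 1ℤ :+ r :* (con (+ 2) :+ r))
                                  := r :+ con 1ℤ :* defectₚ r z) (λ _ → refl) r Z))
    ; coeff₂  = ≈-trans (⊛ᵇ-coeff-suc (z[1-ru]-linear r) (F-closed r ⊕ᵇ G-closed r) 1) (modulo-r (C 1ℤ)
                  (solve 2 (λ r z → z :* ((con 1ℤ :+ r) :* z :* [1+ r ]²ₚ :* con 1ℤ :+ [1+ r ]²ₚ :* (r :* (r :* con 1ℤ)))
                                    :+ (:- (z :* r)) :* (z :* [1+ r ]²ₚ :+ [1+ r ]²ₚ :* (r :* con 1ℤ))
                                  := r :+ con 1ℤ :* defectₚ r z) (λ _ → refl) r Z))
    ; coeff₃₊ = λ j → ≈-trans (⊛ᵇ-coeff-suc (z[1-ru]-linear r) (F-closed r ⊕ᵇ G-closed r) (2 ℕ.+ j))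
                  (solve 3 (λ r z t → z :* ((con 1ℤ :+ r) :* z :* [1+ r ]²ₚ :* (r :* t) :+ [1+ r ]²ₚ :* (r :* (r :* (r :* t))))
                                      :+ (:- (z :* r)) :* ((con 1ℤ :+ r) :* z :* [1+ r ]²ₚ :* t :+ [1+ r ]²ₚ :* (r :* (r :* t)))
                                    := con 0ℤ) (λ _ → refl) r Z (r ^ₛ j)) })
    (FG-rhs-quadratic r)

EndsWith : Bool → List Step → Set
EndsWith b p = ∃[ s ] (last p ≡ just s × isUp s ≡ b)

EmptyOrEndsWith : Bool → List Step → Set
EmptyOrEndsWith b p = p ≡ [] ⊎ EndsWith b p

AltPath : ℕ → ℕ → List Step → Set
AltPath n k p = length p ≡ n × Alternating p × walk 0 p ≡ just k

last-∷ʳ : ∀ (q : List Step) s → last (q ∷ʳ s) ≡ just s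
last-∷ʳ []          s = refl
last-∷ʳ (x ∷ [])    s = refl
last-∷ʳ (x ∷ y ∷ q) s = last-∷ʳ (y ∷ q) s

length-∷ʳ : ∀ (q : List Step) s → length (q ∷ʳ s) ≡ suc (length q)
length-∷ʳ q s = trans (length-++ q) (ℕP.+-comm (length q) 1)

not-flip : ∀ {b c} → b ≡ not c → c ≡ not b
not-flip {b} {c} b≡¬c = trans (sym (not-involutive c)) (cong not (sym b≡¬c))

walk-++ : ∀ {a b} p q → walk a p ≡ just b → walk a (p ++ q) ≡ walk b q
walk-++         []      q refl = refl
walk-++ {a} (s ∷ p) q w  with step a s
walk-++     (s ∷ p) q w  | just a′ = walk-++ p q w
walk-++     (s ∷ p) q () | nothing

walk-∷ʳ⁻ : ∀ {a k} q s → walk a (q ∷ʳ s) ≡ just k → ∃[ h ] (walk a q ≡ just h × step h s ≡ just k)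
walk-∷ʳ⁻ {a} []      s w  with step a s in eq
walk-∷ʳ⁻ {a} []      s w  | just a′ = a , refl , trans eq w
walk-∷ʳ⁻     []      s () | nothing
walk-∷ʳ⁻ {a} (x ∷ q) s w  with step a x
walk-∷ʳ⁻     (x ∷ q) s w  | just a′ = walk-∷ʳ⁻ q s w
walk-∷ʳ⁻     (x ∷ q) s () | nothing

walk-∷ʳ⁺ : ∀ {a h k} q s → walk a q ≡ just h → step h s ≡ just k → walk a (q ∷ʳ s) ≡ just k
walk-∷ʳ⁺ {h = h} q s wq st = trans (walk-++ q (s ∷ []) wq) (walk-[ h ] s st)
  where
  walk-[_] : ∀ h s {k} → step h s ≡ just k → walk h (s ∷ []) ≡ just k
  walk-[ h ] s st with step h s
  walk-[ h ] s st | just _  = st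
  walk-[ h ] s () | nothing

alternating-++⁻ˡ : ∀ p q → Alternating (p ++ q) → Alternating p
alternating-++⁻ˡ []          q _       = tt
alternating-++⁻ˡ (s ∷ [])    q _       = tt
alternating-++⁻ˡ (s ∷ t ∷ p) q (e , a) = e , alternating-++⁻ˡ (t ∷ p) q a

alternating-++ : ∀ p c → Alternating p → Alternating c →
  (∀ s t → last p ≡ just s → head c ≡ just t → isUp t ≡ not (isUp s)) → Alternating (p ++ c)
alternating-++ []           c       _        ac _    = ac
alternating-++ (s ∷ [])     []      _        _  _    = tt
alternating-++ (s ∷ [])     (t ∷ c) _        ac turn = turn s t refl refl , ac
alternating-++ (s ∷ s′ ∷ p) c       (e , ap) ac turn = e , alternating-++ (s′ ∷ p) c ap ac turn

alternating-∷ʳ⁻ : ∀ q s → Alternating (q ∷ʳ s) → EmptyOrEndsWith (not (isUp s)) q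
alternating-∷ʳ⁻ []          s _       = inj₁ refl
alternating-∷ʳ⁻ (x ∷ [])    s (e , _) = inj₂ (x , refl , not-flip e)
alternating-∷ʳ⁻ (x ∷ y ∷ q) s (_ , a) with alternating-∷ʳ⁻ (y ∷ q) s a
... | inj₂ ends = inj₂ ends

alternating-∷ʳ⁺ : ∀ q s → Alternating q → EmptyOrEndsWith (not (isUp s)) q → Alternating (q ∷ʳ s)
alternating-∷ʳ⁺ []          s _       _                        = tt
alternating-∷ʳ⁺ (x ∷ [])    s _       (inj₂ (.x , refl , up)) = not-flip up , tt
alternating-∷ʳ⁺ (x ∷ y ∷ q) s (e , a) (inj₂ ends)             = e , alternating-∷ʳ⁺ (y ∷ q) s a (inj₂ ends)

AltPath-∷ʳ⁺ : ∀ {n h k q s} → AltPath n h q → step h s ≡ just k → EmptyOrEndsWith (not (isUp s)) q →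
  AltPath (suc n) k (q ∷ʳ s)
AltPath-∷ʳ⁺ {q = q} {s} (len , alt , w) st ends =
  trans (length-∷ʳ q s) (cong suc len) , alternating-∷ʳ⁺ q s alt ends , walk-∷ʳ⁺ q s w st

AltPath-∷ʳ⁻ : ∀ {n k} q s → AltPath (suc n) k (q ∷ʳ s) →
  EmptyOrEndsWith (not (isUp s)) q × ∃[ h ] (AltPath n h q × step h s ≡ just k)
AltPath-∷ʳ⁻ q s (len , alt , w) with walk-∷ʳ⁻ q s w
... | h , wq , st = alternating-∷ʳ⁻ q s alt
                  , h , (ℕP.suc-injective (trans (sym (length-∷ʳ q s)) len) , alternating-++⁻ˡ q (s ∷ []) alt , wq) , st

EmptyOrEndsWith-∷ʳ : ∀ {b} q s → EmptyOrEndsWith b (q ∷ʳ s) → isUp s ≡ b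
EmptyOrEndsWith-∷ʳ []      s (inj₂ (.s , refl , up)) = up
EmptyOrEndsWith-∷ʳ (x ∷ q) s (inj₂ (t , l , up)) with just-injective (trans (sym (last-∷ʳ (x ∷ q) s)) l)
... | refl = up

descend : ℕ → List Step
descend zero    = []
descend (suc h) = E ∷ N̄ ∷ descend h

walk-descend : ∀ h → walk h (descend h) ≡ just 0
walk-descend zero    = refl
walk-descend (suc h) = walk-descend h

alternating-descend : ∀ h → Alternating (descend h)
alternating-descend zero          = tt
alternating-descend (suc zero)    = refl , tt
alternating-descend (suc (suc h)) = refl , refl , alternating-descend (suc h)

alternating-Ē∷descend : ∀ h → Alternating (Ē ∷ descend h)
alternating-Ē∷descend zero    = tt
alternating-Ē∷descend (suc h) = refl , alternating-descend (suc h)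

head-descend : ∀ h {t} → head (descend h) ≡ just t → isUp t ≡ true
head-descend (suc h) refl = refl

partialZigzag⇒alternating : ∀ {p} → PartialZigzag p → Alternating p
partialZigzag⇒alternating {p} (q , _ , alt) = alternating-++⁻ˡ p q alt

alternating⇒partialZigzag : ∀ {p k} → walk 0 p ≡ just k → Alternating p → PartialZigzag p
alternating⇒partialZigzag {p} w alt with initLast p
... | []      = [] , refl , tt
... | q ∷ʳ′ s with walk-∷ʳ⁻ q s w
... | h , _ , st = finish s st w alt
  where
  completedBy : ∀ {s k} c → walk 0 (q ∷ʳ s) ≡ just k → walk k c ≡ just 0 → Alternating (q ∷ʳ s) → Alternating c →
    (∀ {t} → head c ≡ just t → isUp t ≡ not (isUp s)) → PartialZigzag (q ∷ʳ s)
  completedBy {s} c w wc alt altc turn = c , trans (walk-++ (q ∷ʳ s) c w) wc ,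
    alternating-++ (q ∷ʳ s) c alt altc (λ s′ t l hc →
      subst (λ x → isUp t ≡ not (isUp x)) (just-injective (trans (sym (last-∷ʳ q s)) l)) (turn hc))
  finish : ∀ s {k} → step h s ≡ just k → walk 0 (q ∷ʳ s) ≡ just k → Alternating (q ∷ʳ s) → PartialZigzag (q ∷ʳ s)
  finish N  refl w alt = completedBy (Ē ∷ descend (suc h)) w (walk-descend (suc h)) alt (alternating-Ē∷descend (suc h))
                                     (λ { refl → refl })
  finish E  refl w alt = completedBy (Ē ∷ descend h) w (walk-descend h) alt (alternating-Ē∷descend h) (λ { refl → refl })
  finish N̄ {k} _ w alt = completedBy (descend k) w (walk-descend k) alt (alternating-descend k) (head-descend k)
  finish Ē {k} _ w alt = completedBy (descend k) w (walk-descend k) alt (alternating-descend k) (head-descend k)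

-- Enumerating alternating paths by their last step

source : Step → ℕ → Maybe ℕ
source N (suc (suc h)) = just h
source N _             = nothing
source E (suc h)       = just h
source E zero          = nothing
source N̄ k             = just (suc (suc k))
source Ē k             = just (suc k)

step⇒source : ∀ h s {k} → step h s ≡ just k → source s k ≡ just h
step⇒source h             N  refl = refl
step⇒source h             E  refl = refl
step⇒source (suc (suc h)) N̄ refl = refl
step⇒source (suc h)       Ē  refl = refl

source⇒step : ∀ s k {h} → source s k ≡ just h → step h s ≡ just k
source⇒step N (suc (suc h)) refl = refl
source⇒step E (suc h)       refl = refl
source⇒step N̄ k             refl = refl
source⇒step Ē k             refl = refl

extend : Step → (ℕ → List (List Step)) → ℕ → List (List Step)
extend s L k = maybe′ (λ h → map (_∷ʳ s) (L h)) [] (source s k)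

∈-extend⁻ : ∀ s L k {p} → p ∈ extend s L k → ∃[ q ] ∃[ h ] (p ≡ q ∷ʳ s × step h s ≡ just k × q ∈ L h)
∈-extend⁻ s L k p∈ with source s k in eq
... | just h with ∈-map⁻ (_∷ʳ s) p∈
...   | q , q∈ , refl = q , h , refl , source⇒step s k eq , q∈

∈-extend⁺ : ∀ {s L k h q} → step h s ≡ just k → q ∈ L h → q ∷ʳ s ∈ extend s L k
∈-extend⁺ {s} {h = h} st q∈ rewrite step⇒source h s st = ∈-map⁺ (_∷ʳ s) q∈

extend-unique : ∀ s L k → (∀ h → Unique (L h)) → Unique (extend s L k)
extend-unique s L k unique with source s k
... | just h  = Unique.map⁺ (λ {q} {q′} → ∷ʳ-injectiveˡ q q′) (unique h)
... | nothing = []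

shortStep longStep : Bool → Step
shortStep true  = E
shortStep false = Ē
longStep true  = N
longStep false = N̄

isUp-shortStep : ∀ b → isUp (shortStep b) ≡ b
isUp-shortStep true  = refl
isUp-shortStep false = refl

isUp-longStep : ∀ b → isUp (longStep b) ≡ b
isUp-longStep true  = refl
isUp-longStep false = refl

extendByKind : Bool → (ℕ → List (List Step)) → ℕ → List (List Step)
extendByKind b L k = extend (shortStep b) L k ++ extend (longStep b) L k

∈-extendByKind⁻ : ∀ b L k {p} → p ∈ extendByKind b L k →
  ∃[ q ] ∃[ s ] ∃[ h ] (isUp s ≡ b × p ≡ q ∷ʳ s × step h s ≡ just k × q ∈ L h)
∈-extendByKind⁻ b L k p∈ with ∈-++⁻ (extend (shortStep b) L k) p∈
... | inj₁ p∈short with ∈-extend⁻ (shortStep b) L k p∈short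
...   | q , h , p≡ , st , q∈ = q , shortStep b , h , isUp-shortStep b , p≡ , st , q∈
∈-extendByKind⁻ b L k p∈ | inj₂ p∈long with ∈-extend⁻ (longStep b) L k p∈long
...   | q , h , p≡ , st , q∈ = q , longStep b , h , isUp-longStep b , p≡ , st , q∈

∈-extendByKind⁺ : ∀ {L k h q} s → step h s ≡ just k → q ∈ L h → q ∷ʳ s ∈ extendByKind (isUp s) L k
∈-extendByKind⁺ {L} {k} N  st q∈ = ∈-++⁺ʳ (extend E L k) (∈-extend⁺ {L = L} st q∈)
∈-extendByKind⁺ {L} {k} N̄ st q∈ = ∈-++⁺ʳ (extend Ē L k) (∈-extend⁺ {L = L} st q∈)
∈-extendByKind⁺ {L}     E  st q∈ = ∈-++⁺ˡ (∈-extend⁺ {L = L} st q∈)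
∈-extendByKind⁺ {L}     Ē  st q∈ = ∈-++⁺ˡ (∈-extend⁺ {L = L} st q∈)

extendByKind-unique : ∀ b L k → (∀ h → Unique (L h)) → Unique (extendByKind b L k)
extendByKind-unique b L k unique =
  Unique.++⁺ (extend-unique (shortStep b) L k unique) (extend-unique (longStep b) L k unique) disjoint
  where
  short≢long : ∀ b → shortStep b ≡ longStep b → ⊥
  short≢long true  ()
  short≢long false ()
  disjoint : ∀ {p} → p ∈ extend (shortStep b) L k × p ∈ extend (longStep b) L k → ⊥
  disjoint (p∈short , p∈long) with ∈-extend⁻ (shortStep b) L k p∈short | ∈-extend⁻ (longStep b) L k p∈long
  ... | q , _ , p≡ , _ | q′ , _ , p≡′ , _ = short≢long b (proj₂ (∷ʳ-injective q q′ (trans (sym p≡) p≡′)))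

initial : ℕ → List (List Step)
initial zero    = [] ∷ []
initial (suc _) = []

paths : Bool → ℕ → ℕ → List (List Step)
paths b zero    = initial
paths b (suc n) = extendByKind b (paths (not b) n)

∈-paths⁻ : ∀ b n k {p} → p ∈ paths b n k → AltPath n k p × EmptyOrEndsWith b p
∈-paths⁻ b zero    zero (here refl) = (refl , tt , refl) , inj₁ refl
∈-paths⁻ b (suc n) k    p∈ with ∈-extendByKind⁻ b (paths (not b) n) k p∈
... | q , s , h , up , refl , st , q∈ with ∈-paths⁻ (not b) n h q∈
... | qpath , qends = AltPath-∷ʳ⁺ qpath st (subst (λ c → EmptyOrEndsWith (not c) q) (sym up) qends)
                    , inj₂ (s , last-∷ʳ q s , up)

∈-paths⁺ : ∀ b n k p → AltPath n k p → EmptyOrEndsWith b p → p ∈ paths b n k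
∈-paths⁺ b zero    .0 []      (_ , _ , refl) _ = here refl
∈-paths⁺ b (suc n) k  p       path           ends with initLast p
∈-paths⁺ b (suc n) k  .[]     (() , _)       ends | []
... | q ∷ʳ′ s with AltPath-∷ʳ⁻ q s path
... | qends , h , qpath , st with EmptyOrEndsWith-∷ʳ q s ends
... | refl = ∈-extendByKind⁺ s st (∈-paths⁺ (not (isUp s)) n h q qpath qends)

paths-unique : ∀ b n k → Unique (paths b n k)
paths-unique b zero    zero    = [] ∷ []
paths-unique b zero    (suc k) = []
paths-unique b (suc n) k       = extendByKind-unique b (paths (not b) n) k (paths-unique (not b) n)

downPaths : ℕ → ℕ → List (List Step)
downPaths zero    _ = []
downPaths (suc n)   = paths false (suc n)

downPaths-unique : ∀ n k → Unique (downPaths n k)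
downPaths-unique zero    k = []
downPaths-unique (suc n) k = paths-unique false (suc n) k

UpPaths⇔∈paths : ∀ n k p → UpPaths n k p ⇔ p ∈ paths true n k
UpPaths⇔∈paths n k p = mk⇔
  (λ { (len , pz , w , ends) → ∈-paths⁺ true n k p (len , partialZigzag⇒alternating pz , w) ends })
  (λ p∈ → let ((len , alt , w) , ends) = ∈-paths⁻ true n k p∈ in len , alternating⇒partialZigzag w alt , w , ends)

nonempty-endsWith : ∀ {n k b} p → AltPath (suc n) k p → EmptyOrEndsWith b p → EndsWith b p
nonempty-endsWith []      (() , _) _
nonempty-endsWith (_ ∷ _) _        (inj₂ ends) = ends

DownPaths⇔∈downPaths : ∀ n k p → DownPaths n k p ⇔ p ∈ downPaths n k
DownPaths⇔∈downPaths zero    k []      = mk⇔ (λ { (_ , _ , _ , _ , () , _) }) (λ ())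
DownPaths⇔∈downPaths zero    k (_ ∷ _) = mk⇔ (λ { (() , _) }) (λ ())
DownPaths⇔∈downPaths (suc n) k p       = mk⇔
  (λ { (len , pz , w , ends) → ∈-paths⁺ false (suc n) k p (len , partialZigzag⇒alternating pz , w) (inj₂ ends) })
  (λ p∈ → let (path@(len , alt , w) , ends) = ∈-paths⁻ false (suc n) k p∈
          in len , alternating⇒partialZigzag w alt , w , nonempty-endsWith p path ends)

HasCount-length : ∀ {P m} L → HasCount P m → (∀ p → P p ⇔ p ∈ L) → Unique L → m ≡ length L
HasCount-length L (xs , len , unique-xs , P⇔∈xs) P⇔∈L unique-L =
  trans (sym len) (↭-length (∼bag⇒↭ (unique∧set⇒bag unique-xs unique-L
    (λ {p} → ⇔.trans (⇔.sym (P⇔∈xs p)) (P⇔∈L p)))))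

upCount downCount : ℕ → Ser
upCount   k n = + length (paths true n k)
downCount k n = + length (downPaths n k)

length-map-++-map : ∀ s s′ (xs ys : List (List Step)) →
  length (map (_∷ʳ s) xs ++ map (_∷ʳ s′) ys) ≡ length xs ℕ.+ length ys
length-map-++-map s s′ xs ys =
  trans (length-++ (map (_∷ʳ s) xs)) (cong₂ ℕ._+_ (length-map (_∷ʳ s) xs) (length-map (_∷ʳ s′) ys))

counting-transfer : Transfer upCount downCount
counting-transfer = record
  { up-zero = λ { zero → refl ; (suc n) → refl }
  ; up-suc  = λ k → ≈-Z⊛ refl (up-suc k)
  ; down    = λ k → ≈-Z⊛ refl (λ n →
                cong +_ (length-map-++-map Ē N̄ (paths true n (suc k)) (paths true n (suc (suc k))))) }
  where
  ready-count : ∀ n h → + length (paths false n h) ≡ ready downCount h n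
  ready-count zero    zero    = refl
  ready-count zero    (suc h) = refl
  ready-count (suc n) zero    = sym (ℤP.+-identityʳ _)
  ready-count (suc n) (suc h) = refl
  up-suc : ∀ k n → upCount (suc k) (suc n) ≡ upSources downCount k n
  up-suc zero    n = trans (cong +_ (trans (length-map-++-map E N (paths false n 0) []) (ℕP.+-identityʳ _)))
                           (ready-count n 0)
  up-suc (suc k) n = trans (cong +_ (length-map-++-map E N (paths false n (suc k)) (paths false n k)))
                           (cong₂ ℤ._+_ (ready-count n (suc k)) (ready-count n k))

theorem4 : (f g : ℕ → ℕ → ℕ)
    → (∀ k n → HasCount (UpPaths n k) (f k n))
    → (∀ k n → HasCount (DownPaths n k) (g k n))
    → (r s : Ser)
    → s 0 ≡ 1ℤ
    → s ⊛ s ≈ C 1ℤ ⊖ C (+ 4) ⊛ Z ⊛ Z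
    → C (+ 2) ⊛ Z ⊛ Z ⊛ r ≈ C 1ℤ ⊖ C (+ 2) ⊛ Z ⊛ Z ⊖ s
    → (ι Z ⊛ᵇ (ι (C 1ℤ) ⊖ᵇ ι r ⊛ᵇ U) ⊛ᵇ (λ k n → + f k n)
          ≈ᵇ ι r ⊛ᵇ U ⊛ᵇ U ⊕ᵇ U ⊛ᵇ ι r ⊛ᵇ ι (C 1ℤ ⊖ Z) ⊕ᵇ ι Z)
      × ((ι (C 1ℤ) ⊖ᵇ ι r ⊛ᵇ U) ⊛ᵇ (λ k n → + g k n)
          ≈ᵇ ι r ⊛ᵇ (U ⊕ᵇ ι r ⊕ᵇ ι (C (+ 2))))
      × (ι Z ⊛ᵇ (ι (C 1ℤ) ⊖ᵇ ι r ⊛ᵇ U) ⊛ᵇ ((λ k n → + f k n) ⊕ᵇ (λ k n → + g k n))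
          ≈ᵇ ι (r ⊛ r ⊛ Z) ⊕ᵇ ι r ⊛ᵇ U ⊛ᵇ U ⊕ᵇ ι r ⊛ᵇ U ⊕ᵇ ι (C (+ 2) ⊛ r ⊛ Z) ⊕ᵇ ι Z)
      × ((λ n → + f 0 n) ≈ C 1ℤ)
      × (∀ k → 1 ≤ k → Z ⊛ (λ n → + f k n) ≈ (C 1ℤ ⊕ r) ⊛ r ^ₛ (k ∸ 1) ⊖ C [ k ≡1])
      × ((λ n → + g 0 n) ≈ r ⊛ (C (+ 2) ⊕ r))
      × (∀ k → 1 ≤ k → Z ⊛ Z ⊛ (λ n → + g k n) ≈ r ^ₛ (suc k))
theorem4 f g f-counts g-counts r s _ s² 2z²r =
    ≈ᵇ-trans (⊛ᵇ-congʳ (ι Z ⊛ᵇ (ι (C 1ℤ) ⊖ᵇ ι r ⊛ᵇ U)) f≈) (F-closed-generating r-eq)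
  , ≈ᵇ-trans (⊛ᵇ-congʳ (ι (C 1ℤ) ⊖ᵇ ι r ⊛ᵇ U) g≈) (G-closed-generating r-eq)
  , ≈ᵇ-trans (⊛ᵇ-congʳ (ι Z ⊛ᵇ (ι (C 1ℤ) ⊖ᵇ ι r ⊛ᵇ U)) (λ k → ⊕-cong (f≈ k) (g≈ k)))
             (FG-closed-generating r-eq)
  , f≈ 0
  , (λ k 1≤k → ≈-trans (⊛-congˡ Z (f≈ k)) (Z⊛F-closed r-eq k 1≤k))
  , g≈ 0
  , (λ k 1≤k → ≈-trans (⊛-congˡ (Z ⊛ Z) (g≈ k)) (Z⊛Z⊛G-closed r-eq k 1≤k))
  where
  r-eq : Z ⊛ Z ⊛ [1+ r ]² ≈ r
  r-eq = quadratic-equation r s s² 2z²r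
  counts≈closed : (∀ k → upCount k ≈ F-closed r k) × (∀ k → downCount k ≈ G-closed r k)
  counts≈closed = transfer-unique counting-transfer (closed-transfer r-eq)
  f≈ : ∀ k → (λ n → + f k n) ≈ F-closed r k
  f≈ k n = trans (cong +_ (HasCount-length _ (f-counts k n) (UpPaths⇔∈paths n k) (paths-unique true n k)))
                 (proj₁ counts≈closed k n)
  g≈ : ∀ k → (λ n → + g k n) ≈ G-closed r k
  g≈ k n = trans (cong +_ (HasCount-length _ (g-counts k n) (DownPaths⇔∈downPaths n k) (downPaths-unique n k)))
                 (proj₂ counts≈closed k n)
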